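{- Let $n\ge 8$ and let $B=\{\mathbf{b}_1,\ldots,\mathbf{b}_6\}$ with $\mathbf{b}_1=\overline{10}[n]$, $\mathbf{b}_2=01\cdot\overline{0}[n-2]$, $\mathbf{b}_3=\overline{0}[n-2]\cdot 11$, $\mathbf{b}_4=\overline{01}[n]$, $\mathbf{b}_5=11\cdot\overline{0}[n-2]$, $\mathbf{b}_6=\overline{0}[n-2]\cdot 10$. If $\mathbf{x}\in\mathbb{F}_2^n\setminus(W_0\cup W_1\cup B)$, then $|T(\mathbf{x})|>\lfloor(3n-1)/2\rfloor$.
   Context: For $\mathbf{x}=(x_0,\ldots,x_{n-1})\in\mathbb{F}_2^n$, the derivative is $\partial\mathbf{x}=(x_0+x_1,\ldots,x_{n-2}+x_{n-1})\in\mathbb{F}_2^{n-1}$, with $\partial^0\mathbf{x}=\mathbf{x}$ and $\partial^i\mathbf{x}=\partial(\partial^{i-1}\mathbf{x})$. The Steinhaus triangle is $T(\mathbf{x})=(\mathbf{x},\partial\mathbf{x},\ldots,\partial^{n-1}\mathbf{x})$; $|\mathbf{y}|$ is the number of ones of a binary sequence and $|T(\mathbf{x})|=\sum_{i=0}^{n-1}|\partial^i\mathbf{x}|$. For fixed $n$, let $0=w_0<w_1<\cdots<w_m$ be the distinct values of $|T(\mathbf{x})|$ over $\mathbf{x}\in\mathbb{F}_2^n$, and $W_i=\{\mathbf{x}\in\mathbb{F}_2^n:|T(\mathbf{x})|=w_i\}$. Sequences are written as words; a dot denotes concatenation; $\overline{x_1\cdots x_p}[k]$ is the word of the first $k$ letters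 of the infinite periodic word $x_1\cdots x_px_1\cdots x_p\cdots$. -}

module Defs where

open import Data.Bool using (Bool; true; false; not; _xor_)
open import Data.Nat using (ℕ; zero; suc; _+_; _<_; _≤_)
open import Data.Vec using (Vec; []; _∷_; replicate)
open import Data.Product using (_×_)
open import Relation.Binary.PropositionalEquality using (_≡_)
open import Relation.Nullary using (¬_)

-- F₂ is represented by Bool (true = 1, false = 0, addition = xor).

ones : ∀ {n} → Vec Bool n → ℕ
ones [] = 0
ones (true ∷ xs) = suc (ones xs)
ones (false ∷ xs) = ones xs

∂ : ∀ {n} → Vec Bool (suc n) → Vec Bool n
∂ (x ∷ []) = []
∂ (x ∷ y ∷ ys) = (x xor y) ∷ ∂ (y ∷ ys)

-- |T(x)| = Σ_{i=0}^{n-1} |∂^i x|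
triWeight : ∀ {n} → Vec Bool n → ℕ
triWeight {zero} [] = 0
triWeight {suc n} x = ones x + triWeight {n} (∂ x)

InW0 : ∀ {n} → Vec Bool n → Set
InW0 x = triWeight x ≡ 0

InW1 : ∀ {n} → Vec Bool n → Set
InW1 {n} x = (0 < triWeight x) × ((y : Vec Bool n) → 0 < triWeight y → triWeight x ≤ triWeight y)

alt : Bool → (n : ℕ) → Vec Bool n
alt b zero = []
alt b (suc n) = b ∷ alt (not b) n

headThenZeros : Bool → Bool → (m : ℕ) → Vec Bool (suc (suc m))
headThenZeros a b m = a ∷ b ∷ replicate m false

zerosThenTail : Bool → Bool → (m : ℕ) → Vec Bool (suc (suc m))
zerosThenTail a b zero = a ∷ b ∷ []
zerosThenTail a b (suc m) = false ∷ zerosThenTail a b m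

b1 b2 b3 b4 b5 b6 : (m : ℕ) → Vec Bool (suc (suc m))
b1 m = alt true (suc (suc m))
b2 m = headThenZeros false true m
b3 m = zerosThenTail true true m
b4 m = alt false (suc (suc m))
b5 m = headThenZeros true true m
b6 m = zerosThenTail true false m

InB : ∀ {m} → Vec Bool (suc (suc m)) → Set
InB {m} x = (x ≡ b1 m) ⊎' ((x ≡ b2 m) ⊎' ((x ≡ b3 m) ⊎' ((x ≡ b4 m) ⊎' ((x ≡ b5 m) ⊎' (x ≡ b6 m)))))
  where open import Data.Sum renaming (_⊎_ to _⊎'_)

-- Every word is the antiderivative of its derivative, so |T(x)| = |x| + |T(∂x)| and one can
-- induct on the length.  If ∂x is one of the nine exceptional words (W₁ ∪ B), then x is
-- itself exceptional, or has at least n − 2 ones, or has an alternating derivative (x is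
-- 4-periodic); the last two force 3n ≤ 2|T(x)|, i.e. |T(x)| > ⌊(3n − 1)/2⌋.  Otherwise ∂x
-- satisfies the bound by induction, and two ones in x are enough to carry it up to x.  A single
-- interior one in x gives two ones in ∂x, and the bound is carried up from ∂²x instead.
-- Lengths 8 and 9 start the induction and are checked exhaustively.
module Submission where

open import Defs
open import Data.Bool using (Bool; true; false; not; _xor_; _∨_; T)
import Data.Bool.Properties as Bool
open import Data.Bool.Properties using (xor-same; xor-identityʳ; xor-inverseʳ; xor-comm; true-xor)
open import Data.Empty using (⊥-elim)
open import Data.List using (List; []; _∷_)
open import Data.List.Membership.Propositional using (_∈_)
open import Data.List.Relation.Unary.Any using (here; there; any?)
open import Data.Nat using (ℕ; zero; suc; _+_; _*_; _∸_; _≤_; _<_; z≤n; s≤s)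
open import Data.Nat.DivMod using (_/_; m<n*o⇒m/o<n)
open import Data.Nat.Properties hiding (_≟_)
open import Data.Nat.Tactic.RingSolver using (solve-∀)
open import Data.Product using (_,_)
open import Data.Sum using (_⊎_; inj₁; inj₂; [_,_]; map₁; map₂)
open import Data.Unit using (tt)
open import Data.Vec using (Vec; []; _∷_; replicate; head)
open import Data.Vec.Properties using (≡-dec; ∷-injectiveʳ)
open import Function using (_∘_)
open import Relation.Binary.Definitions using (DecidableEquality)
open import Relation.Binary.PropositionalEquality
  using (_≡_; refl; sym; trans; cong; cong₂; subst; module ≡-Reasoning)
open import Relation.Nullary using (¬_; Dec; yes; no)
open import Relation.Nullary.Decidable using (True; toWitness; map′; _×-dec_; _⊎-dec_)

_≟_ : ∀ {n} → DecidableEquality (Vec Bool n)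
_≟_ = ≡-dec Bool._≟_

ones-replicate-false : ∀ n → ones (replicate n false) ≡ 0
ones-replicate-false zero = refl
ones-replicate-false (suc n) = ones-replicate-false n

ones-replicate-true : ∀ n → ones (replicate n true) ≡ n
ones-replicate-true zero = refl
ones-replicate-true (suc n) = cong suc (ones-replicate-true n)

ones≡0⇒replicate-false : ∀ {n} (x : Vec Bool n) → ones x ≡ 0 → x ≡ replicate n false
ones≡0⇒replicate-false [] _ = refl
ones≡0⇒replicate-false (false ∷ x) e = cong (false ∷_) (ones≡0⇒replicate-false x e)

ones-≤-∷ : ∀ {n} a (x : Vec Bool n) → ones x ≤ ones (a ∷ x)
ones-≤-∷ true x = n≤1+n (ones x)
ones-≤-∷ false x = ≤-refl

∂-replicate : ∀ n a → ∂ (replicate (suc n) a) ≡ replicate n false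
∂-replicate zero a = refl
∂-replicate (suc n) a = cong₂ _∷_ (xor-same a) (∂-replicate n a)

triWeight-replicate-false : ∀ n → triWeight (replicate n false) ≡ 0
triWeight-replicate-false zero = refl
triWeight-replicate-false (suc n) =
  cong₂ _+_ (ones-replicate-false n) (trans (cong triWeight (∂-replicate n false)) (triWeight-replicate-false n))

triWeight-replicate-true : ∀ n → triWeight (replicate n true) ≡ n
triWeight-replicate-true zero = refl
triWeight-replicate-true (suc n) = begin
  suc (ones (replicate n true)) + triWeight (∂ (replicate (suc n) true))
    ≡⟨ cong₂ (λ o w → suc o + w) (ones-replicate-true n) (cong triWeight (∂-replicate n true)) ⟩
  suc n + triWeight (replicate n false)
    ≡⟨ cong (suc n +_) (triWeight-replicate-false n) ⟩
  suc n + 0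
    ≡⟨ +-identityʳ (suc n) ⟩
  suc n ∎
  where open ≡-Reasoning

triWeight-true∷zeros : ∀ n → triWeight (true ∷ replicate n false) ≡ suc n
triWeight-true∷zeros zero = refl
triWeight-true∷zeros (suc n) =
  cong₂ (λ o w → suc o + w) (ones-replicate-false n)
    (trans (cong (triWeight ∘ (true ∷_)) (∂-replicate n false)) (triWeight-true∷zeros n))

triWeight-zeros∷true : ∀ m → triWeight (zerosThenTail false true m) ≡ suc (suc m)
triWeight-zeros∷true zero = refl
triWeight-zeros∷true (suc m) =
  cong₂ _+_ (ones-zeros∷true m) (trans (cong triWeight (∂-zeros∷true m)) (triWeight-zeros∷true m))
  where
  ones-zeros∷true : ∀ m → ones (zerosThenTail false true m) ≡ 1
  ones-zeros∷true zero = refl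
  ones-zeros∷true (suc m) = ones-zeros∷true m
  ∂-zeros∷true : ∀ m → ∂ (zerosThenTail false true (suc m)) ≡ zerosThenTail false true m
  ∂-zeros∷true zero = refl
  ∂-zeros∷true (suc m) = cong (false ∷_) (∂-zeros∷true m)

∫ : ∀ {n} → Bool → Vec Bool n → Vec Bool (suc n)
∫ a [] = a ∷ []
∫ a (b ∷ y) = a ∷ ∫ (a xor b) y

xor-cancelˡ : ∀ a b → a xor (a xor b) ≡ b
xor-cancelˡ true b = Bool.not-involutive b
xor-cancelˡ false b = refl

∫-∂ : ∀ {n} (x : Vec Bool (suc n)) → ∫ (head x) (∂ x) ≡ x
∫-∂ (a ∷ []) = refl
∫-∂ (a ∷ b ∷ x) = cong (a ∷_) (trans (cong (λ c → ∫ c (∂ (b ∷ x))) (xor-cancelˡ a b)) (∫-∂ (b ∷ x)))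

∂-∫ : ∀ {n} a (y : Vec Bool n) → ∂ (∫ a y) ≡ y
∂-∫ a [] = refl
∂-∫ a (b ∷ []) = cong (_∷ []) (xor-cancelˡ a b)
∂-∫ a (b ∷ c ∷ y) = cong₂ _∷_ (xor-cancelˡ a b) (∂-∫ (a xor b) (c ∷ y))

∫-replicate-false : ∀ n a → ∫ a (replicate n false) ≡ replicate (suc n) a
∫-replicate-false zero a = refl
∫-replicate-false (suc n) a =
  cong (a ∷_) (trans (cong (λ c → ∫ c (replicate n false)) (xor-identityʳ a)) (∫-replicate-false n a))

∫-replicate-true : ∀ n a → ∫ a (replicate n true) ≡ alt a (suc n)
∫-replicate-true zero a = refl
∫-replicate-true (suc n) a =
  cong (a ∷_) (trans (cong (λ c → ∫ c (replicate n true)) (trans (xor-comm a true) (true-xor a)))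
                     (∫-replicate-true n (not a)))

∫-headThenZeros : ∀ h a b m → ∫ h (headThenZeros a b m) ≡ h ∷ (h xor a) ∷ replicate (suc m) ((h xor a) xor b)
∫-headThenZeros h a b m = cong (λ v → h ∷ (h xor a) ∷ v) (∫-replicate-false m ((h xor a) xor b))

∫-false-zerosThenTail : ∀ a b m → ∫ false (zerosThenTail a b m) ≡ zerosThenTail a (a xor b) (suc m)
∫-false-zerosThenTail a b zero = refl
∫-false-zerosThenTail a b (suc m) = cong (false ∷_) (∫-false-zerosThenTail a b m)

ones-∫-true-zerosThenTail : ∀ a b m → suc m ≤ ones (∫ true (zerosThenTail a b m))
ones-∫-true-zerosThenTail a b zero = s≤s z≤n
ones-∫-true-zerosThenTail a b (suc m) = s≤s (ones-∫-true-zerosThenTail a b m)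

∂≡zeros⇒constant : ∀ {n} (x : Vec Bool (suc n)) → ∂ x ≡ replicate n false → x ≡ replicate (suc n) (head x)
∂≡zeros⇒constant {n} x ∂x≡0 = begin
  x                              ≡⟨ ∫-∂ x ⟨
  ∫ (head x) (∂ x)               ≡⟨ cong (∫ (head x)) ∂x≡0 ⟩
  ∫ (head x) (replicate n false) ≡⟨ ∫-replicate-false n (head x) ⟩
  replicate (suc n) (head x)     ∎
  where open ≡-Reasoning

length≤triWeight : ∀ {n} (x : Vec Bool n) → ¬ x ≡ replicate n false → n ≤ triWeight x
length≤triWeight [] _ = z≤n
length≤triWeight {suc n} x x≢0 with ∂ x ≟ replicate n false
... | no ∂x≢0 = +-mono-≤ (n≢0⇒n>0 (x≢0 ∘ ones≡0⇒replicate-false x)) (length≤triWeight (∂ x) ∂x≢0)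
... | yes ∂x≡0 = constant (head x) (∂≡zeros⇒constant x ∂x≡0)
  where
  constant : ∀ a → x ≡ replicate (suc n) a → suc n ≤ triWeight x
  constant true x≡1 = ≤-reflexive (sym (trans (cong triWeight x≡1) (triWeight-replicate-true (suc n))))
  constant false x≡0 = ⊥-elim (x≢0 x≡0)

period4 : Bool → Bool → (n : ℕ) → Vec Bool n
period4 a b zero = []
period4 a b (suc n) = a ∷ period4 b (not a) n

∫-alt : ∀ n a b → ∫ a (alt b n) ≡ period4 a (a xor b) (suc n)
∫-alt zero a b = refl
∫-alt (suc n) a b =
  cong (a ∷_) (trans (∫-alt n (a xor b) (not b)) (cong (λ c → period4 (a xor b) c (suc n)) (xor-xor-not a b)))
  where
  xor-xor-not : ∀ a b → (a xor b) xor not b ≡ not a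
  xor-xor-not true true = refl
  xor-xor-not true false = refl
  xor-xor-not false true = refl
  xor-xor-not false false = refl

∂-alt : ∀ n b → ∂ (alt b (suc n)) ≡ replicate n true
∂-alt zero b = refl
∂-alt (suc n) b = cong₂ _∷_ (xor-inverseʳ b) (∂-alt n (not b))

triWeight-alt : ∀ n b → triWeight (alt b (suc n)) ≡ ones (alt b (suc n)) + n
triWeight-alt n b = cong (ones (alt b (suc n)) +_) (trans (cong triWeight (∂-alt n b)) (triWeight-replicate-true n))

≤-+-2* : ∀ c d {n o} → n ≤ c + 2 * o → 2 * d + n ≤ c + 2 * (d + o)
≤-+-2* c d {n} {o} n≤ = begin
  2 * d + n           ≤⟨ +-monoʳ-≤ (2 * d) n≤ ⟩
  2 * d + (c + 2 * o) ≡⟨ rearrange c d o ⟩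
  c + 2 * (d + o)     ∎
  where
  open ≤-Reasoning
  rearrange : ∀ c d o → 2 * d + (c + 2 * o) ≡ c + 2 * (d + o)
  rearrange = solve-∀

ones-alt : ∀ b n → n ≤ 1 + 2 * ones (alt b n)
ones-alt b zero = z≤n
ones-alt b (suc zero) = m≤m+n 1 _
ones-alt true (suc (suc n)) = ≤-+-2* 1 1 (ones-alt true n)
ones-alt false (suc (suc n)) = ≤-+-2* 1 1 (ones-alt false n)

ones-period4 : ∀ a b n → n ≤ 3 + 2 * ones (period4 a b n)
ones-period4 a b zero = z≤n
ones-period4 a b (suc zero) = ≤-trans (s≤s z≤n) (m≤m+n 3 _)
ones-period4 a b (suc (suc zero)) = ≤-trans (s≤s (s≤s z≤n)) (m≤m+n 3 _)
ones-period4 a b (suc (suc (suc zero))) = m≤m+n 3 _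
ones-period4 a b (suc (suc (suc (suc n)))) =
  subst (λ o → 4 + n ≤ 3 + 2 * o) (sym (ones-period4-4+ a b)) (≤-+-2* 3 2 (ones-period4 a b n))
  where
  ones-period4-4+ : ∀ a b → ones (period4 a b (4 + n)) ≡ 2 + ones (period4 a b n)
  ones-period4-4+ true true = refl
  ones-period4-4+ true false = refl
  ones-period4-4+ false true = refl
  ones-period4-4+ false false = refl

ones-alternating-derivative : ∀ {n b} (x : Vec Bool (suc n)) → ∂ x ≡ alt b n → suc n ≤ 3 + 2 * ones x
ones-alternating-derivative {n} {b} x ∂x≡alt =
  subst (λ v → suc n ≤ 3 + 2 * ones v) x-periodic (ones-period4 (head x) (head x xor b) (suc n))
  where
  x-periodic : period4 (head x) (head x xor b) (suc n) ≡ x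
  x-periodic = trans (sym (∫-alt n (head x) b)) (trans (cong (∫ (head x)) (sym ∂x≡alt)) (∫-∂ x))

-- W₁ ∪ B: sparse-head 1 0, sparse-tail 0 1 and all-ones are the nonzero words of minimal weight.
data Exceptional {m : ℕ} : Vec Bool (suc (suc m)) → Set where
  sparse-head : ∀ {a b} → T (a ∨ b) → Exceptional (headThenZeros a b m)
  sparse-tail : ∀ {a b} → T (a ∨ b) → Exceptional (zerosThenTail a b m)
  all-ones    : Exceptional (replicate (suc (suc m)) true)
  alternating : ∀ b → Exceptional (alt b (suc (suc m)))

Exceptional⇒≢zeros : ∀ {m} {x : Vec Bool (suc (suc m))} → Exceptional x → ¬ x ≡ replicate _ false
Exceptional⇒≢zeros (sparse-head {true} _) ()
Exceptional⇒≢zeros (sparse-head {false} {true} _) ()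
Exceptional⇒≢zeros (sparse-tail a∨b) = zerosThenTail≢zeros _ a∨b
  where
  zerosThenTail≢zeros : ∀ {a b} m → T (a ∨ b) → ¬ zerosThenTail a b m ≡ replicate (suc (suc m)) false
  zerosThenTail≢zeros {true} zero _ ()
  zerosThenTail≢zeros {false} {true} zero _ ()
  zerosThenTail≢zeros (suc m) a∨b eq = zerosThenTail≢zeros m a∨b (∷-injectiveʳ eq)
Exceptional⇒≢zeros all-ones ()
Exceptional⇒≢zeros (alternating true) ()
Exceptional⇒≢zeros (alternating false) ()

length-weight⇒InW1 : ∀ {n} (x : Vec Bool (suc n)) → triWeight x ≡ suc n → InW1 x
length-weight⇒InW1 {n} x w≡n = subst (0 <_) (sym w≡n) (s≤s z≤n) , minimal
  where
  minimal : ∀ y → 0 < triWeight y → triWeight x ≤ triWeight y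
  minimal y pos = subst (_≤ triWeight y) (sym w≡n)
    (length≤triWeight y (λ y≡0 → <⇒≢ pos (sym (trans (cong triWeight y≡0) (triWeight-replicate-false (suc n))))))

Exceptional⇒InW1⊎InB : ∀ {m} {x : Vec Bool (suc (suc m))} → Exceptional x → InW1 x ⊎ InB x
Exceptional⇒InW1⊎InB {m} (sparse-head {true} {false} _) =
  inj₁ (length-weight⇒InW1 (headThenZeros true false m) (triWeight-true∷zeros (suc m)))
Exceptional⇒InW1⊎InB (sparse-head {false} {true} _) = inj₂ (inj₂ (inj₁ refl))
Exceptional⇒InW1⊎InB (sparse-head {true} {true} _) = inj₂ (inj₂ (inj₂ (inj₂ (inj₂ (inj₁ refl)))))
Exceptional⇒InW1⊎InB {m} (sparse-tail {false} {true} _) =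
  inj₁ (length-weight⇒InW1 (zerosThenTail false true m) (triWeight-zeros∷true m))
Exceptional⇒InW1⊎InB (sparse-tail {true} {true} _) = inj₂ (inj₂ (inj₂ (inj₁ refl)))
Exceptional⇒InW1⊎InB (sparse-tail {true} {false} _) = inj₂ (inj₂ (inj₂ (inj₂ (inj₂ (inj₂ refl)))))
Exceptional⇒InW1⊎InB {m} all-ones =
  inj₁ (length-weight⇒InW1 (replicate (suc (suc m)) true) (triWeight-replicate-true (suc (suc m))))
Exceptional⇒InW1⊎InB (alternating true) = inj₂ (inj₁ refl)
Exceptional⇒InW1⊎InB (alternating false) = inj₂ (inj₂ (inj₂ (inj₂ (inj₁ refl))))

constant-word : ∀ {m} (x : Vec Bool (suc (suc m))) → ∂ x ≡ replicate _ false → x ≡ replicate _ false ⊎ Exceptional x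
constant-word (false ∷ x) ∂x≡0 = inj₁ (∂≡zeros⇒constant _ ∂x≡0)
constant-word (true ∷ x) ∂x≡0 = inj₂ (subst Exceptional (sym (∂≡zeros⇒constant _ ∂x≡0)) all-ones)

single-one : ∀ {m} (x : Vec Bool (suc (suc m))) → ones x ≡ 1 →
  x ≡ headThenZeros true false m ⊎ x ≡ zerosThenTail false true m ⊎ ones (∂ x) ≡ 2
single-one (true ∷ x) e = inj₁ (cong (true ∷_) (ones≡0⇒replicate-false x (suc-injective e)))
single-one {zero} (false ∷ true ∷ []) _ = inj₂ (inj₁ refl)
single-one {suc m} (false ∷ true ∷ x) e with ones≡0⇒replicate-false x (suc-injective e)
... | refl = inj₂ (inj₂ (cong (2 +_) (trans (cong ones (∂-replicate m false)) (ones-replicate-false m))))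
single-one {suc m} (false ∷ false ∷ x) e with single-one (false ∷ x) e
... | inj₂ (inj₁ eq) = inj₂ (inj₁ (cong (false ∷_) eq))
... | inj₂ (inj₂ eq) = inj₂ (inj₂ eq)

data AntiderivativeOfExceptional {m : ℕ} (x : Vec Bool (suc (suc (suc m)))) : Set where
  exceptional            : Exceptional x → AntiderivativeOfExceptional x
  many-ones              : suc m ≤ ones x → AntiderivativeOfExceptional x
  alternating-derivative : ∀ b → ∂ x ≡ alt b (suc (suc m)) → AntiderivativeOfExceptional x

∫-Exceptional : ∀ {m} h {y : Vec Bool (suc (suc m))} → Exceptional y → AntiderivativeOfExceptional (∫ h y)
∫-Exceptional {m} h (sparse-head {a} {b} a∨b) rewrite ∫-headThenZeros h a b m = cases h a b a∨b
  where
  many : ∀ a c → suc m ≤ ones (a ∷ c ∷ replicate (suc m) true)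
  many a c = ≤-trans (≤-reflexive (sym (ones-replicate-true (suc m)))) (≤-trans (ones-≤-∷ c _) (ones-≤-∷ a _))
  cases : ∀ h a b → T (a ∨ b) →
    AntiderivativeOfExceptional (h ∷ (h xor a) ∷ replicate (suc m) ((h xor a) xor b))
  cases false true false _ = many-ones (many false true)
  cases false true true _ = exceptional (sparse-head tt)
  cases false false true _ = many-ones (many false false)
  cases true true false _ = exceptional (sparse-head tt)
  cases true true true _ = many-ones (many true false)
  cases true false true _ = exceptional (sparse-head tt)
∫-Exceptional {m} false (sparse-tail {a} {b} a∨b) rewrite ∫-false-zerosThenTail a b m =
  exceptional (sparse-tail (∨-xor a b a∨b))
  where
  ∨-xor : ∀ a b → T (a ∨ b) → T (a ∨ (a xor b))
  ∨-xor true b _ = tt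
  ∨-xor false true _ = tt
∫-Exceptional {m} true (sparse-tail {a} {b} _) = many-ones (ones-∫-true-zerosThenTail a b m)
∫-Exceptional {m} h all-ones rewrite ∫-replicate-true (suc (suc m)) h = exceptional (alternating h)
∫-Exceptional h (alternating b) = alternating-derivative b (∂-∫ h _)

antiderivative-of-exceptional : ∀ {m} (x : Vec Bool (suc (suc (suc m)))) →
  Exceptional (∂ x) → AntiderivativeOfExceptional x
antiderivative-of-exceptional x ∂x-exc =
  subst AntiderivativeOfExceptional (∫-∂ x) (∫-Exceptional (head x) ∂x-exc)

-- 3n ≤ 2|T(x)| is equivalent to ⌊(3n − 1)/2⌋ < |T(x)|.
Heavy : ∀ {n} → Vec Bool n → Set
Heavy {n} x = 3 * n ≤ 2 * triWeight x

heavy-+ : ∀ {c s n w} → 3 * c ≤ 2 * s → 3 * n ≤ 2 * w → 3 * (c + n) ≤ 2 * (s + w)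
heavy-+ {c} {s} {n} {w} h₁ h₂ = begin
  3 * (c + n)     ≡⟨ *-distribˡ-+ 3 c n ⟩
  3 * c + 3 * n   ≤⟨ +-mono-≤ h₁ h₂ ⟩
  2 * s + 2 * w   ≡⟨ *-distribˡ-+ 2 s w ⟨
  2 * (s + w)     ∎
  where open ≤-Reasoning

heavy-derivative : ∀ {n} (x : Vec Bool (suc n)) → 2 ≤ ones x → Heavy (∂ x) → Heavy x
heavy-derivative {n} x 2≤ones =
  heavy-+ {1} {ones x} {n} {triWeight (∂ x)} (≤-trans (n≤1+n 3) (*-monoʳ-≤ 2 2≤ones))

heavy-second-derivative : ∀ {n} (x : Vec Bool (suc (suc n))) →
  3 ≤ ones x + ones (∂ x) → Heavy (∂ (∂ x)) → Heavy x
heavy-second-derivative {n} x 3≤ones ∂²x-heavy =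
  subst (λ s → 3 * (2 + n) ≤ 2 * s) (+-assoc (ones x) (ones (∂ x)) (triWeight (∂ (∂ x))))
    (heavy-+ {2} {ones x + ones (∂ x)} {n} {triWeight (∂ (∂ x))} (*-monoʳ-≤ 2 3≤ones) ∂²x-heavy)

sparse-antiderivative : ∀ k (x : Vec Bool (8 + k)) → ones x ≤ 2 → Exceptional (∂ x) → Exceptional x
sparse-antiderivative k x sparse ∂x-exc with antiderivative-of-exceptional x ∂x-exc
... | exceptional x-exc = x-exc
... | many-ones many with ≤-trans many sparse
...   | s≤s (s≤s ())
sparse-antiderivative k x sparse ∂x-exc | alternating-derivative b ∂x≡alt
  with ≤-trans (ones-alternating-derivative x ∂x≡alt) (+-monoʳ-≤ 3 (*-monoʳ-≤ 2 sparse))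
... | s≤s (s≤s (s≤s (s≤s (s≤s (s≤s (s≤s ()))))))

exceptional-derivative : ∀ k (x : Vec Bool (9 + k)) → Exceptional (∂ x) → Exceptional x ⊎ Heavy x
exceptional-derivative k x ∂x-exc with antiderivative-of-exceptional x ∂x-exc
... | exceptional x-exc = inj₁ x-exc
... | many-ones many = inj₂ (begin
  3 * (9 + k)                 ≤⟨ m≤m+n _ (3 + k) ⟩
  3 * (9 + k) + (3 + k)       ≡⟨ rearrange k ⟩
  2 * ((7 + k) + (8 + k))     ≤⟨ *-monoʳ-≤ 2 (+-mono-≤ many (length≤triWeight (∂ x) (Exceptional⇒≢zeros ∂x-exc))) ⟩
  2 * triWeight x             ∎)
  where
  open ≤-Reasoning
  rearrange : ∀ k → 3 * (9 + k) + (3 + k) ≡ 2 * ((7 + k) + (8 + k))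
  rearrange = solve-∀
... | alternating-derivative b ∂x≡alt = inj₂ (begin
  3 * (9 + k)                                ≤⟨ m≤m+n _ k ⟩
  3 * (9 + k) + k                            ≡⟨ rearrange₁ k ⟩
  (6 + k) + (7 + k) + 2 * (7 + k)            ≤⟨ +-monoˡ-≤ _ (+-mono-≤ ones-x ones-y) ⟩
  2 * ones x + 2 * ones y + 2 * (7 + k)      ≡⟨ rearrange₂ (ones x) (ones y) k ⟩
  2 * (ones x + (ones y + (7 + k)))          ≡⟨ cong (λ w → 2 * (ones x + w)) (triWeight-alt (7 + k) b) ⟨
  2 * (ones x + triWeight (alt b (8 + k)))   ≡⟨ cong (λ y → 2 * (ones x + triWeight y)) ∂x≡alt ⟨
  2 * triWeight x                            ∎)
  where
  open ≤-Reasoning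
  y = alt b (8 + k)
  ones-x : 6 + k ≤ 2 * ones x
  ones-x = +-cancelˡ-≤ 3 _ _ (ones-alternating-derivative x ∂x≡alt)
  ones-y : 7 + k ≤ 2 * ones y
  ones-y = +-cancelˡ-≤ 1 _ _ (ones-alt b (8 + k))
  rearrange₁ : ∀ k → 3 * (9 + k) + k ≡ (6 + k) + (7 + k) + 2 * (7 + k)
  rearrange₁ = solve-∀
  rearrange₂ : ∀ o o′ k → 2 * o + 2 * o′ + 2 * (7 + k) ≡ 2 * (o + (o′ + (7 + k)))
  rearrange₂ = solve-∀

ZeroExceptionalOrHeavy : ∀ {m} → Vec Bool (suc (suc m)) → Set
ZeroExceptionalOrHeavy x = x ≡ replicate _ false ⊎ Exceptional x ⊎ Heavy x

AllZeroExceptionalOrHeavy : ℕ → Set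
AllZeroExceptionalOrHeavy m = (x : Vec Bool (suc (suc m))) → ZeroExceptionalOrHeavy x

interior-one : ∀ k (x : Vec Bool (10 + k)) → ones x ≡ 1 → ones (∂ x) ≡ 2 →
  ZeroExceptionalOrHeavy (∂ (∂ x)) → Exceptional x ⊎ Heavy x
interior-one k x ones-x ones-∂x (inj₂ (inj₂ ∂²x-heavy)) =
  inj₂ (heavy-second-derivative x (≤-reflexive (sym (cong₂ _+_ ones-x ones-∂x))) ∂²x-heavy)
interior-one k x ones-x ones-∂x (inj₂ (inj₁ ∂²x-exc)) =
  inj₁ (sparse-antiderivative (2 + k) x (≤-trans (≤-reflexive ones-x) (n≤1+n 1))
    (sparse-antiderivative (1 + k) (∂ x) (≤-reflexive ones-∂x) ∂²x-exc))
interior-one k x ones-x ones-∂x (inj₁ ∂²x≡0) with constant-word (∂ x) ∂²x≡0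
... | inj₁ ∂x≡0 =
  ⊥-elim (0≢1+n (trans (sym (trans (cong ones ∂x≡0) (ones-replicate-false (9 + k)))) ones-∂x))
... | inj₂ ∂x-exc = inj₁ (sparse-antiderivative (2 + k) x (≤-trans (≤-reflexive ones-x) (n≤1+n 1)) ∂x-exc)

zero-one-or-more : ∀ n → n ≡ 0 ⊎ n ≡ 1 ⊎ 2 ≤ n
zero-one-or-more zero = inj₁ refl
zero-one-or-more (suc zero) = inj₂ (inj₁ refl)
zero-one-or-more (suc (suc n)) = inj₂ (inj₂ (s≤s (s≤s z≤n)))

induction-step : ∀ k → AllZeroExceptionalOrHeavy (6 + k) → AllZeroExceptionalOrHeavy (7 + k) →
  AllZeroExceptionalOrHeavy (8 + k)
induction-step k ih₀ ih₁ x with ih₁ (∂ x)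
... | inj₁ ∂x≡0 = map₂ inj₁ (constant-word x ∂x≡0)
... | inj₂ (inj₁ ∂x-exc) = inj₂ (exceptional-derivative (suc k) x ∂x-exc)
... | inj₂ (inj₂ ∂x-heavy) with zero-one-or-more (ones x)
...   | inj₁ ones-x = inj₁ (ones≡0⇒replicate-false x ones-x)
...   | inj₂ (inj₂ 2≤ones) = inj₂ (inj₂ (heavy-derivative x 2≤ones ∂x-heavy))
...   | inj₂ (inj₁ ones-x) with single-one x ones-x
...     | inj₁ refl = inj₂ (inj₁ (sparse-head tt))
...     | inj₂ (inj₁ refl) = inj₂ (inj₁ (sparse-tail tt))
...     | inj₂ (inj₂ ones-∂x) = inj₂ (interior-one k x ones-x ones-∂x (ih₀ (∂ (∂ x))))

exceptional-words : ∀ m → List (Vec Bool (suc (suc m)))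
exceptional-words m =
  headThenZeros true false m ∷ headThenZeros false true m ∷ headThenZeros true true m ∷
  zerosThenTail false true m ∷ zerosThenTail true true m ∷ zerosThenTail true false m ∷
  replicate _ true ∷ alt true _ ∷ alt false _ ∷ []

∈-exceptional-words : ∀ {m} {x : Vec Bool (suc (suc m))} → x ∈ exceptional-words m → Exceptional x
∈-exceptional-words (here refl) = sparse-head tt
∈-exceptional-words (there (here refl)) = sparse-head tt
∈-exceptional-words (there (there (here refl))) = sparse-head tt
∈-exceptional-words (there (there (there (here refl)))) = sparse-tail tt
∈-exceptional-words (there (there (there (there (here refl))))) = sparse-tail tt
∈-exceptional-words (there (there (there (there (there (here refl)))))) = sparse-tail tt
∈-exceptional-words (there (there (there (there (there (there (here refl))))))) = all-ones
∈-exceptional-words (there (there (there (there (there (there (there (here refl)))))))) = alternating true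
∈-exceptional-words (there (there (there (there (there (there (there (there (here refl))))))))) = alternating false

all-words? : ∀ {n} {P : Vec Bool n → Set} → (∀ x → Dec (P x)) → Dec (∀ x → P x)
all-words? {zero} P? = map′ (λ p → λ { [] → p }) (λ f → f []) (P? [])
all-words? {suc n} P? = map′ (λ (p₁ , p₀) → λ { (true ∷ x) → p₁ x ; (false ∷ x) → p₀ x })
  (λ f → (λ x → f (true ∷ x)) , (λ x → f (false ∷ x)))
  (all-words? (λ x → P? (true ∷ x)) ×-dec all-words? (λ x → P? (false ∷ x)))

all-zero-exceptional-or-heavy? : ∀ m →
  Dec ((x : Vec Bool (suc (suc m))) → x ≡ replicate _ false ⊎ x ∈ exceptional-words m ⊎ Heavy x)
all-zero-exceptional-or-heavy? m = all-words? λ x →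
  x ≟ replicate _ false ⊎-dec any? (x ≟_) (exceptional-words m) ⊎-dec 3 * suc (suc m) ≤? 2 * triWeight x

by-exhaustion : ∀ m → True (all-zero-exceptional-or-heavy? m) → AllZeroExceptionalOrHeavy m
by-exhaustion m ok x = map₂ (map₁ ∈-exceptional-words) (toWitness ok x)

all-zero-exceptional-or-heavy : ∀ k → AllZeroExceptionalOrHeavy (6 + k)
all-zero-exceptional-or-heavy zero = by-exhaustion 6 tt
all-zero-exceptional-or-heavy (suc zero) = by-exhaustion 7 tt
all-zero-exceptional-or-heavy (suc (suc k)) =
  induction-step k (all-zero-exceptional-or-heavy k) (all-zero-exceptional-or-heavy (suc k))

3n≤2w⇒[3n∸1]/2<w : ∀ n {w} → 3 * suc n ≤ 2 * w → (3 * suc n ∸ 1) / 2 < w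
3n≤2w⇒[3n∸1]/2<w n {w} 3n≤2w = m<n*o⇒m/o<n (subst (3 * suc n ≤_) (*-comm 2 w) 3n≤2w)

proposition5p5 : (m : ℕ) → 8 ≤ suc (suc m) → (x : Vec Bool (suc (suc m))) →
    ¬ InW0 x → ¬ InW1 x → ¬ InB x →
    (3 * suc (suc m) ∸ 1) / 2 < triWeight x
proposition5p5 m 8≤n x ¬W0 ¬W1 ¬B with m≤n⇒∃[o]m+o≡n 8≤n
... | k , refl with all-zero-exceptional-or-heavy k x
...   | inj₁ x≡0 = ⊥-elim (¬W0 (trans (cong triWeight x≡0) (triWeight-replicate-false (8 + k))))
...   | inj₂ (inj₁ x-exc) = ⊥-elim ([ ¬W1 , ¬B ] (Exceptional⇒InW1⊎InB x-exc))
...   | inj₂ (inj₂ x-heavy) = 3n≤2w⇒[3n∸1]/2<w (7 + k) x-heavy
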